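{- Let $q$ be a prime power, $F_q$ the field with $q$ elements, $V=F_q^n$, and $1<k<n-1$. Let $S$ be a $(k-1)$-dimensional subspace of $V$ having a generator matrix of the form $M=[I_{k-1}\ A]$ with rows $v_1,\dots,v_{k-1}$, where $I_{k-1}$ is the $(k-1)\times(k-1)$ identity matrix and $A$ is a $(k-1)\times(n-k+1)$ matrix over $F_q$. Let $W$ be the set of all vectors $w\in V$ whose first $k-1$ coordinates are $0$ and such that the matrix obtained by appending $w$ as a last row to $M$ generates a $k$-dimensional projective code. Then the following are equivalent: (i) $[S\rangle^{\Pi}_{k}$ is a star of $\Pi[n,k]_q$ and $\dim\langle W\rangle=2$; (ii) $[S\rangle^{\Pi}_{k}=\langle U]^{\Pi}_{k}$, where $U=\langle v_1,\dots,v_{k-1},w_1,w_2\rangle$ is a $(k+1)$-dimensional subspace of $V$ with $w_1,w_2\in W$.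
   Context: A linear code $[n,k]_q$ is a $k$-dimensional subspace of $V=F_q^n$; a generator matrix is a matrix whose rows form a basis of it. A code is projective if the columns of a generator matrix are non-zero and pairwise non-proportional. $\Pi(n,k)_q$ denotes the set of all $k$-dimensional projective codes in $V$, and $\Pi[n,k]_q$ is the simple graph with vertex set $\Pi(n,k)_q$ in which two distinct codes are adjacent iff their intersection is $(k-1)$-dimensional. A clique is a set of pairwise adjacent vertices; it is maximal if not properly contained in another clique. $[S\rangle^{\Pi}_{k}$ denotes the set of all elements of $\Pi(n,k)_q$ containing $S$; it is called a star of $\Pi[n,k]_q$ if it is a maximal clique of $\Pi[n,k]_q$. For a $(k+1)$-dimensional subspace $U$, $\langle U]^{\Pi}_{k}$ denotes the set of all elements of $\Pi(n,k)_q$ contained in $U$. -}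

module Defs where

open import Level using (Level; _⊔_)
open import Data.Nat using (ℕ; zero; suc; _<_; _^_)
open import Data.Nat.Primality using (Prime)
open import Data.Fin using (Fin; toℕ)
import Data.Fin as Fin
import Data.Vec.Functional as VF
open import Data.Product using (Σ; ∃; ∃-syntax; _×_; _,_)
open import Relation.Nullary using (¬_)
open import Relation.Binary.PropositionalEquality using (_≡_; _≢_)
open import Algebra.Bundles using (CommutativeRing)

IsPrimePower : ℕ → Set
IsPrimePower q = ∃[ p ] ∃[ m ] (Prime p × q ≡ p ^ suc m)

IsField : ∀ {c ℓ} → CommutativeRing c ℓ → Set (c ⊔ ℓ)
IsField R = (¬ (1# ≈ 0#)) × (∀ x → ¬ (x ≈ 0#) → ∃[ y ] (x * y ≈ 1#))
  where open CommutativeRing R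

HasCardinality : ∀ {c ℓ} → CommutativeRing c ℓ → ℕ → Set (c ⊔ ℓ)
HasCardinality R q =
  Σ (Fin q → Carrier) λ e →
    (∀ i j → e i ≈ e j → i ≡ j) × (∀ x → ∃[ i ] (e i ≈ x))
  where open CommutativeRing R

module Codes {c ℓ} (F : CommutativeRing c ℓ) where
  open CommutativeRing F

  Vec : ℕ → Set c
  Vec n = Fin n → Carrier

  _≈v_ : ∀ {n} → Vec n → Vec n → Set ℓ
  u ≈v v = ∀ j → u j ≈ v j

  0v : ∀ {n} → Vec n
  0v _ = 0#

  _+v_ : ∀ {n} → Vec n → Vec n → Vec n
  (u +v v) j = u j + v j

  _·v_ : ∀ {n} → Carrier → Vec n → Vec n
  (a ·v v) j = a * v j

  sumv : ∀ {n m} → (Fin m → Vec n) → Vec n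
  sumv {m = zero}  vs = 0v
  sumv {m = suc m} vs = vs Fin.zero +v sumv (λ i → vs (Fin.suc i))

  lincomb : ∀ {n m} → (Fin m → Carrier) → (Fin m → Vec n) → Vec n
  lincomb cs vs = sumv (λ i → cs i ·v vs i)

  Subset : ℕ → Set (Level.suc (c ⊔ ℓ))
  Subset n = Vec n → Set (c ⊔ ℓ)

  _⊆_ : ∀ {n} → Subset n → Subset n → Set (c ⊔ ℓ)
  A ⊆ B = ∀ x → A x → B x

  _≐_ : ∀ {n} → Subset n → Subset n → Set (c ⊔ ℓ)
  A ≐ B = (A ⊆ B) × (B ⊆ A)

  _∩_ : ∀ {n} → Subset n → Subset n → Subset n
  (A ∩ B) x = A x × B x

  span : ∀ {n m} → (Fin m → Vec n) → Subset n
  span vs x = ∃[ cs ] (x ≈v lincomb cs vs)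

  spanSet : ∀ {n} → Subset n → Subset n
  spanSet X x = ∃[ m ] Σ (Fin m → Vec _) λ vs →
                  (∀ i → X (vs i)) × ∃[ cs ] (x ≈v lincomb cs vs)

  LinIndep : ∀ {n m} → (Fin m → Vec n) → Set (c ⊔ ℓ)
  LinIndep vs = ∀ cs → lincomb cs vs ≈v 0v → ∀ i → cs i ≈ 0#

  IsGenMatrix : ∀ {n k} → (Fin k → Vec n) → Subset n → Set (c ⊔ ℓ)
  IsGenMatrix G C = LinIndep G × (C ≐ span G)

  IsSubspaceOfDim : ∀ {n} → ℕ → Subset n → Set (c ⊔ ℓ)
  IsSubspaceOfDim {n} k C = Σ (Fin k → Vec n) λ G → IsGenMatrix G C

  column : ∀ {n k} → (Fin k → Vec n) → Fin n → Vec k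
  column G j i = G i j

  ProjectiveColumns : ∀ {n k} → (Fin k → Vec n) → Set (c ⊔ ℓ)
  ProjectiveColumns G =
    (∀ j → ¬ (column G j ≈v 0v)) ×
    (∀ j j′ → j ≢ j′ → ¬ (∃[ a ] (column G j ≈v (a ·v column G j′))))

  IsProjectiveCode : ∀ {n} → ℕ → Subset n → Set (c ⊔ ℓ)
  IsProjectiveCode {n} k C =
    Σ (Fin k → Vec n) λ G → IsGenMatrix G C × ProjectiveColumns G

  Adjacent : ∀ {n} → ℕ → Subset n → Subset n → Set (c ⊔ ℓ)
  Adjacent k C D = (¬ (C ≐ D)) × IsSubspaceOfDim (k Data.Nat.∸ 1) (C ∩ D)

  VSet : ℕ → Set (Level.suc (c ⊔ ℓ))
  VSet n = Subset n → Set (c ⊔ ℓ)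

  _⊆V_ : ∀ {n} → VSet n → VSet n → Set (Level.suc (c ⊔ ℓ))
  X ⊆V Y = ∀ C → X C → Y C

  _≐V_ : ∀ {n} → VSet n → VSet n → Set (Level.suc (c ⊔ ℓ))
  X ≐V Y = (X ⊆V Y) × (Y ⊆V X)

  IsClique : ∀ {n} → ℕ → VSet n → Set (Level.suc (c ⊔ ℓ))
  IsClique k X =
    (∀ C → X C → IsProjectiveCode k C) ×
    (∀ C D → X C → X D → ¬ (C ≐ D) → Adjacent k C D)

  IsMaximalClique : ∀ {n} → ℕ → VSet n → Set (Level.suc (c ⊔ ℓ))
  IsMaximalClique {n} k X = IsClique k X × (∀ (Y : VSet n) → IsClique k Y → X ⊆V Y → Y ⊆V X)

  starSet : ∀ {n} → ℕ → Subset n → VSet n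
  starSet k S C = IsProjectiveCode k C × (S ⊆ C)

  topSet : ∀ {n} → ℕ → Subset n → VSet n
  topSet k U C = IsProjectiveCode k C × (C ⊆ U)

  IsStar : ∀ {n} → ℕ → Subset n → Set (Level.suc (c ⊔ ℓ))
  IsStar k S = IsMaximalClique k (starSet k S)

  appendRow : ∀ {n m} → (Fin m → Vec n) → Vec n → (Fin (m Data.Nat.+ 1) → Vec n)
  appendRow vs w = vs VF.++ (w VF.∷ VF.[])

  append2Rows : ∀ {n m} → (Fin m → Vec n) → Vec n → Vec n → (Fin (m Data.Nat.+ 2) → Vec n)
  append2Rows vs w₁ w₂ = vs VF.++ (w₁ VF.∷ w₂ VF.∷ VF.[])

  IdentityPrefix : ∀ {n m} → (Fin m → Vec n) → Set ℓ
  IdentityPrefix {m = m} vs = ∀ i j → toℕ j < m →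
    (toℕ i ≡ toℕ j → vs i j ≈ 1#) × (toℕ i ≢ toℕ j → vs i j ≈ 0#)

  Wset : ∀ {n m} → ℕ → (Fin m → Vec n) → Subset n
  Wset {m = m} k vs w =
    (∀ j → toℕ j < m → w j ≈ 0#) × IsProjectiveCode k (span (appendRow vs w))

-- Over a finite field equality of vectors and membership in a span are decidable, so the
-- exchange-lemma arguments of linear algebra go through constructively.
--
-- A code C ⊇ S of dimension k contains a vector x ∉ S; subtracting from x the combination of
-- the rows of [I A] that agrees with x on the pivot columns gives w ∈ C with zero prefix and
-- C = ⟨v, w⟩, hence w ∈ W. So if ⟨W⟩ = ⟨w₁, w₂⟩, every member of [S⟩ lies in
-- U = ⟨v, w₁, w₂⟩. Two distinct k-dimensional subspaces of a space spanned by k + 1 vectors meet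
-- in dimension k - 1, so [S⟩ together with any member of ⟨U] is a clique, and maximality of the
-- star gives [S⟩ = ⟨U]. Conversely, if [S⟩ = ⟨U] then W ⊆ U, and W having zero prefix forces
-- ⟨W⟩ = ⟨w₁, w₂⟩. A code D in a clique containing [S⟩ but not contained in U meets ⟨v, w₁⟩ and
-- ⟨v, w₂⟩ in hyperplanes; counting dimensions inside D shows D ∩ U ⊆ ⟨v, w₂⟩, so the hyperplane
-- D ∩ ⟨v, w₁⟩ lies in ⟨v, w₁⟩ ∩ ⟨v, w₂⟩ = S and is therefore S, whence S ⊆ D.
module Submission where

open import Defs
open import Data.Nat using (ℕ; suc; _<_; _∸_)
open import Data.Fin using (Fin)
open import Data.Product using (∃-syntax; _×_)
open import Function.Bundles using (_⇔_; mk⇔)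
open import Algebra.Bundles using (CommutativeRing)

open import Level using (_⊔_)
open import Data.Nat as ℕ using (zero; _≤_; s≤s)
import Data.Nat.Properties as ℕP
open import Data.Fin as Fin using (toℕ; punchIn; _↑ˡ_; _↑ʳ_; splitAt)
import Data.Fin.Properties as FinP
import Data.Vec.Functional as VF
open import Data.Vec.Functional.Properties
  using (lookup-++ˡ; lookup-++ʳ; insertAt-lookup; insertAt-punchIn)
open import Data.Product using (Σ; ∃; _,_; proj₁; proj₂)
open import Data.Sum using (_⊎_; inj₁; inj₂)
open import Data.Empty using (⊥-elim)
open import Relation.Nullary using (¬_; Dec; yes; no; contradiction)
import Relation.Binary.PropositionalEquality as P
open P using (_≡_)
open import Function using (_∘_)
import Algebra.Solver.Ring.NaturalCoefficients.Default as Solver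
import Algebra.Properties.Ring as RingProperties
import Algebra.Properties.CommutativeSemigroup as CommutativeSemigroupProperties
import Relation.Binary.Reasoning.Setoid as SetoidReasoning

↑-elim : ∀ {p} m {r} {Q : Fin (m ℕ.+ r) → Set p} →
  (∀ a → Q (a ↑ˡ r)) → (∀ b → Q (m ↑ʳ b)) → ∀ i → Q i
↑-elim m {Q = Q} Qˡ Qʳ i with splitAt m i in eq
... | inj₁ a = P.subst Q (FinP.splitAt⁻¹-↑ˡ eq) (Qˡ a)
... | inj₂ b = P.subst Q (FinP.splitAt⁻¹-↑ʳ eq) (Qʳ b)

all-++ : ∀ {a p} {A : Set a} {Q : A → Set p} {m r} (u : Fin m → A) (w : Fin r → A) →
  (∀ i → Q (u i)) → (∀ i → Q (w i)) → ∀ i → Q ((u VF.++ w) i)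
all-++ {Q = Q} {m} u w Qu Qw =
  ↑-elim m (λ a → P.subst Q (P.sym (lookup-++ˡ u w a)) (Qu a))
           (λ b → P.subst Q (P.sym (lookup-++ʳ u w b)) (Qw b))

module VectorSpace {c ℓ} (F : CommutativeRing c ℓ) where
  open CommutativeRing F
  open Codes F
  open Solver commutativeSemiring using (solve; _:+_; _:*_; _:=_)
  open RingProperties ring using (-1*x≈-x; -‿involutive; +-inverseʳ-unique)
  open CommutativeSemigroupProperties +-commutativeSemigroup using (x∙yz≈y∙xz; xy∙z≈y∙xz)
  open SetoidReasoning setoid

  ≈v-refl : ∀ {n} {x : Vec n} → x ≈v x
  ≈v-refl _ = refl

  ≈v-sym : ∀ {n} {x y : Vec n} → x ≈v y → y ≈v x
  ≈v-sym x≈y j = sym (x≈y j)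

  ≈v-trans : ∀ {n} {x y z : Vec n} → x ≈v y → y ≈v z → x ≈v z
  ≈v-trans x≈y y≈z j = trans (x≈y j) (y≈z j)

  +v-cong : ∀ {n} {x x′ y y′ : Vec n} → x ≈v x′ → y ≈v y′ → (x +v y) ≈v (x′ +v y′)
  +v-cong x≈x′ y≈y′ j = +-cong (x≈x′ j) (y≈y′ j)

  ·v-cong : ∀ {n} {a b} {x y : Vec n} → a ≈ b → x ≈v y → (a ·v x) ≈v (b ·v y)
  ·v-cong a≈b x≈y j = *-cong a≈b (x≈y j)

  -- Named so that the semiring solver can treat it as a variable in identities involving negation.
  -1# : Carrier
  -1# = - 1#

  x+-1*x≈0 : ∀ x → x + -1# * x ≈ 0#
  x+-1*x≈0 x = trans (+-congˡ (-1*x≈-x x)) (-‿inverseʳ x)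

  -1*-1≈1 : -1# * -1# ≈ 1#
  -1*-1≈1 = trans (-1*x≈-x -1#) (-‿involutive 1#)

  x+y≈0⇒y≈-1*x : ∀ {x y} → x + y ≈ 0# → y ≈ -1# * x
  x+y≈0⇒y≈-1*x {x} {y} x+y≈0 = trans (+-inverseʳ-unique x y x+y≈0) (sym (-1*x≈-x x))

  sumv-cong : ∀ {n m} (vs ws : Fin m → Vec n) → (∀ i → vs i ≈v ws i) → sumv vs ≈v sumv ws
  sumv-cong {m = zero}  vs ws vs≈ws = ≈v-refl
  sumv-cong {m = suc m} vs ws vs≈ws =
    +v-cong (vs≈ws Fin.zero) (sumv-cong (vs ∘ Fin.suc) (ws ∘ Fin.suc) (vs≈ws ∘ Fin.suc))

  sumv-punchIn : ∀ {n m} (vs : Fin (suc m) → Vec n) i → sumv vs ≈v (vs i +v sumv (vs ∘ punchIn i))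
  sumv-punchIn vs Fin.zero = ≈v-refl
  sumv-punchIn {m = suc m} vs (Fin.suc i) j =
    trans (+-congˡ (sumv-punchIn (vs ∘ Fin.suc) i j)) (x∙yz≈y∙xz _ _ _)

  sumv-++ : ∀ {n} m r (vs : Fin (m ℕ.+ r) → Vec n) →
    sumv vs ≈v (sumv (vs ∘ (_↑ˡ r)) +v sumv (vs ∘ (m ↑ʳ_)))
  sumv-++ zero    r vs j = sym (+-identityˡ _)
  sumv-++ (suc m) r vs j = trans (+-congˡ (sumv-++ m r (vs ∘ Fin.suc) j)) (sym (+-assoc _ _ _))

  ∑ : ∀ {m} → (Fin m → Carrier) → Carrier
  ∑ f = sumv {n = 1} (λ i _ → f i) Fin.zero

  ∑-cong : ∀ {m} (f g : Fin m → Carrier) → (∀ i → f i ≈ g i) → ∑ f ≈ ∑ g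
  ∑-cong f g f≈g = sumv-cong {n = 1} _ _ (λ i _ → f≈g i) Fin.zero

  ∑-punchIn : ∀ {m} (f : Fin (suc m) → Carrier) i → ∑ f ≈ f i + ∑ (f ∘ punchIn i)
  ∑-punchIn f i = sumv-punchIn {n = 1} (λ i _ → f i) i Fin.zero

  ∑-distribʳ : ∀ {m} (f : Fin m → Carrier) x → ∑ (λ i → f i * x) ≈ ∑ f * x
  ∑-distribʳ {zero}  f x = sym (zeroˡ x)
  ∑-distribʳ {suc m} f x = trans (+-congˡ (∑-distribʳ (f ∘ Fin.suc) x)) (sym (distribʳ x _ _))

  lincomb-cong : ∀ {n m} {cs ds : Fin m → Carrier} {vs ws : Fin m → Vec n} →
    (∀ i → cs i ≈ ds i) → (∀ i → vs i ≈v ws i) → lincomb cs vs ≈v lincomb ds ws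
  lincomb-cong cs≈ds vs≈ws = sumv-cong _ _ (λ i → ·v-cong (cs≈ds i) (vs≈ws i))

  lincomb-zeros : ∀ {n m} (cs : Fin m → Carrier) (vs : Fin m → Vec n) →
    (∀ i → cs i ≈ 0#) → lincomb cs vs ≈v 0v
  lincomb-zeros {m = zero}  cs vs cs≈0 = ≈v-refl
  lincomb-zeros {m = suc m} cs vs cs≈0 j =
    trans (+-cong (trans (*-congʳ (cs≈0 Fin.zero)) (zeroˡ _))
                  (lincomb-zeros (cs ∘ Fin.suc) (vs ∘ Fin.suc) (cs≈0 ∘ Fin.suc) j))
          (+-identityˡ _)

  lincomb-vanishes-at : ∀ {n m} (cs : Fin m → Carrier) (vs : Fin m → Vec n) j →
    (∀ i → vs i j ≈ 0#) → lincomb cs vs j ≈ 0#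
  lincomb-vanishes-at {m = zero}  cs vs j vs≈0 = refl
  lincomb-vanishes-at {m = suc m} cs vs j vs≈0 =
    trans (+-cong (trans (*-congˡ (vs≈0 Fin.zero)) (zeroʳ _))
                  (lincomb-vanishes-at (cs ∘ Fin.suc) (vs ∘ Fin.suc) j (vs≈0 ∘ Fin.suc)))
          (+-identityˡ _)

  lincomb-++ : ∀ {n m r} (cs : Fin (m ℕ.+ r) → Carrier) (u : Fin m → Vec n) (w : Fin r → Vec n) →
    lincomb cs (u VF.++ w) ≈v (lincomb (cs ∘ (_↑ˡ r)) u +v lincomb (cs ∘ (m ↑ʳ_)) w)
  lincomb-++ {m = m} {r} cs u w =
    ≈v-trans (sumv-++ m r _)
      (+v-cong (sumv-cong _ _ (λ i → ·v-cong refl (λ j → reflexive (P.cong (λ x → x j) (lookup-++ˡ u w i)))))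
               (sumv-cong _ _ (λ i → ·v-cong refl (λ j → reflexive (P.cong (λ x → x j) (lookup-++ʳ u w i))))))

  lincomb-++-zerosˡ : ∀ {n m r} (cs : Fin (m ℕ.+ r) → Carrier) (u : Fin m → Vec n) (w : Fin r → Vec n) →
    (∀ a → cs (a ↑ˡ r) ≈ 0#) → lincomb cs (u VF.++ w) ≈v lincomb (cs ∘ (m ↑ʳ_)) w
  lincomb-++-zerosˡ {r = r} cs u w cs≈0 j =
    trans (lincomb-++ cs u w j)
          (trans (+-congʳ (lincomb-zeros (cs ∘ (_↑ˡ r)) u cs≈0 j)) (+-identityˡ _))

  lincomb-+ : ∀ {n m} (cs ds : Fin m → Carrier) (vs : Fin m → Vec n) →
    lincomb (λ i → cs i + ds i) vs ≈v (lincomb cs vs +v lincomb ds vs)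
  lincomb-+ {m = zero}  cs ds vs j = sym (+-identityˡ _)
  lincomb-+ {m = suc m} cs ds vs j =
    trans (+-congˡ (lincomb-+ (cs ∘ Fin.suc) (ds ∘ Fin.suc) (vs ∘ Fin.suc) j))
          (rearrange (cs Fin.zero) (ds Fin.zero) (vs Fin.zero j) _ _)
    where
    rearrange : ∀ a b x s t → (a + b) * x + (s + t) ≈ (a * x + s) + (b * x + t)
    rearrange = solve 5 (λ a b x s t → ((a :+ b) :* x :+ (s :+ t)) := ((a :* x :+ s) :+ (b :* x :+ t))) refl

  lincomb-* : ∀ {n m} a (cs : Fin m → Carrier) (vs : Fin m → Vec n) →
    lincomb (λ i → a * cs i) vs ≈v (a ·v lincomb cs vs)
  lincomb-* {m = zero}  a cs vs j = sym (zeroʳ _)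
  lincomb-* {m = suc m} a cs vs j =
    trans (+-congˡ (lincomb-* a (cs ∘ Fin.suc) (vs ∘ Fin.suc) j))
          (rearrange a (cs Fin.zero) (vs Fin.zero j) _)
    where
    rearrange : ∀ a b x s → (a * b) * x + a * s ≈ a * (b * x + s)
    rearrange = solve 4 (λ a b x s → ((a :* b) :* x :+ a :* s) := (a :* (b :* x :+ s))) refl

  lincomb-affine : ∀ {n m} (β t : Fin m → Carrier) (x : Fin m → Vec n) (y : Vec n) →
    lincomb β (λ i → x i +v (t i ·v y)) ≈v (lincomb β x +v (∑ (λ i → β i * t i) ·v y))
  lincomb-affine {m = zero}  β t x y j = sym (trans (+-identityˡ _) (zeroˡ _))
  lincomb-affine {m = suc m} β t x y j =
    trans (+-congˡ (lincomb-affine (β ∘ Fin.suc) (t ∘ Fin.suc) (x ∘ Fin.suc) y j))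
          (rearrange (β Fin.zero) (t Fin.zero) (x Fin.zero j) (y j) _ _)
    where
    rearrange : ∀ b t x y s u → b * (x + t * y) + (s + u * y) ≈ (b * x + s) + (b * t + u) * y
    rearrange = solve 6 (λ b t x y s u →
      (b :* (x :+ t :* y) :+ (s :+ u :* y)) := ((b :* x :+ s) :+ (b :* t :+ u) :* y)) refl

  record IsSubspace {n} (Q : Subset n) : Set (c ⊔ ℓ) where
    field
      resp-≈v   : ∀ {x y} → x ≈v y → Q x → Q y
      0v-closed : Q 0v
      +v-closed : ∀ {x y} → Q x → Q y → Q (x +v y)
      ·v-closed : ∀ a {x} → Q x → Q (a ·v x)
  open IsSubspace public

  span-isSubspace : ∀ {n m} (g : Fin m → Vec n) → IsSubspace (span g)
  resp-≈v   (span-isSubspace g) x≈y (cs , x≈) = cs , ≈v-trans (≈v-sym x≈y) x≈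
  0v-closed (span-isSubspace g) = (λ _ → 0#) , ≈v-sym (lincomb-zeros _ g (λ _ → refl))
  +v-closed (span-isSubspace g) (cs , x≈) (ds , y≈) =
    (λ i → cs i + ds i) , ≈v-trans (+v-cong x≈ y≈) (≈v-sym (lincomb-+ cs ds g))
  ·v-closed (span-isSubspace g) a (cs , x≈) =
    (λ i → a * cs i) , ≈v-trans (·v-cong refl x≈) (≈v-sym (lincomb-* a cs g))

  ≐-isSubspace : ∀ {n} {A B : Subset n} → A ≐ B → IsSubspace B → IsSubspace A
  resp-≈v   (≐-isSubspace (A⊆B , B⊆A) B-sub) x≈y x∈A = B⊆A _ (resp-≈v B-sub x≈y (A⊆B _ x∈A))
  0v-closed (≐-isSubspace (A⊆B , B⊆A) B-sub) = B⊆A _ (0v-closed B-sub)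
  +v-closed (≐-isSubspace (A⊆B , B⊆A) B-sub) x∈A y∈A = B⊆A _ (+v-closed B-sub (A⊆B _ x∈A) (A⊆B _ y∈A))
  ·v-closed (≐-isSubspace (A⊆B , B⊆A) B-sub) a x∈A = B⊆A _ (·v-closed B-sub a (A⊆B _ x∈A))

  ∩-isSubspace : ∀ {n} {A B : Subset n} → IsSubspace A → IsSubspace B → IsSubspace (A ∩ B)
  resp-≈v   (∩-isSubspace A-sub B-sub) x≈y (x∈A , x∈B) = resp-≈v A-sub x≈y x∈A , resp-≈v B-sub x≈y x∈B
  0v-closed (∩-isSubspace A-sub B-sub) = 0v-closed A-sub , 0v-closed B-sub
  +v-closed (∩-isSubspace A-sub B-sub) (x∈A , x∈B) (y∈A , y∈B) =
    +v-closed A-sub x∈A y∈A , +v-closed B-sub x∈B y∈B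
  ·v-closed (∩-isSubspace A-sub B-sub) a (x∈A , x∈B) = ·v-closed A-sub a x∈A , ·v-closed B-sub a x∈B

  difference-closed : ∀ {n} {Q : Subset n} → IsSubspace Q → ∀ {x y} → Q x → Q y → Q (x +v (-1# ·v y))
  difference-closed Q-sub x∈Q y∈Q = +v-closed Q-sub x∈Q (·v-closed Q-sub _ y∈Q)

  lincomb-closed : ∀ {n m} {Q : Subset n} → IsSubspace Q → (cs : Fin m → Carrier) (vs : Fin m → Vec n) →
    (∀ i → Q (vs i)) → Q (lincomb cs vs)
  lincomb-closed {m = zero}  Q-sub cs vs vs∈Q = 0v-closed Q-sub
  lincomb-closed {m = suc m} Q-sub cs vs vs∈Q =
    +v-closed Q-sub (·v-closed Q-sub _ (vs∈Q Fin.zero))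
                    (lincomb-closed Q-sub (cs ∘ Fin.suc) (vs ∘ Fin.suc) (vs∈Q ∘ Fin.suc))

  span-least : ∀ {n m} {Q : Subset n} → IsSubspace Q → (g : Fin m → Vec n) → (∀ i → Q (g i)) → span g ⊆ Q
  span-least Q-sub g g∈Q x (cs , x≈) = resp-≈v Q-sub (≈v-sym x≈) (lincomb-closed Q-sub cs g g∈Q)

  unit : ∀ {m} → Fin m → Fin m → Carrier
  unit i j with i FinP.≟ j
  ... | yes _ = 1#
  ... | no _  = 0#

  unit-diagonal : ∀ {m} (i : Fin m) → unit i i ≈ 1#
  unit-diagonal i with i FinP.≟ i
  ... | yes _  = refl
  ... | no i≢i = contradiction P.refl i≢i

  unit-offDiagonal : ∀ {m} (i j : Fin m) → i P.≢ j → unit i j ≈ 0#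
  unit-offDiagonal i j i≢j with i FinP.≟ j
  ... | yes i≡j = contradiction i≡j i≢j
  ... | no _    = refl

  lincomb-unit : ∀ {n m} (g : Fin (suc m) → Vec n) i → lincomb (unit i) g ≈v g i
  lincomb-unit g i j = begin
    lincomb (unit i) g j
      ≈⟨ sumv-punchIn (λ t → unit i t ·v g t) i j ⟩
    unit i i * g i j + lincomb (unit i ∘ punchIn i) (g ∘ punchIn i) j
      ≈⟨ +-cong (*-congʳ (unit-diagonal i)) (lincomb-zeros _ (g ∘ punchIn i) off-diagonal j) ⟩
    1# * g i j + 0#
      ≈⟨ +-identityʳ _ ⟩
    1# * g i j
      ≈⟨ *-identityˡ _ ⟩
    g i j ∎
    where
    off-diagonal : ∀ t → unit i (punchIn i t) ≈ 0#
    off-diagonal t = unit-offDiagonal i _ (λ eq → FinP.punchInᵢ≢i i t (P.sym eq))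

  generator∈span : ∀ {n m} (g : Fin m → Vec n) i → span g (g i)
  generator∈span {m = suc m} g i = unit i , ≈v-sym (lincomb-unit g i)

  span-++ˡ : ∀ {n m r} (u : Fin m → Vec n) (w : Fin r → Vec n) → span u ⊆ span (u VF.++ w)
  span-++ˡ {r = r} u w = span-least (span-isSubspace _) u λ i →
    P.subst (span (u VF.++ w)) (lookup-++ˡ u w i) (generator∈span _ (i ↑ˡ r))

  span-++ʳ : ∀ {n m r} (u : Fin m → Vec n) (w : Fin r → Vec n) → span w ⊆ span (u VF.++ w)
  span-++ʳ {m = m} u w = span-least (span-isSubspace _) w λ i →
    P.subst (span (u VF.++ w)) (lookup-++ʳ u w i) (generator∈span _ (m ↑ʳ i))

  span-cong : ∀ {n m} (u u′ : Fin m → Vec n) → (∀ i → u i ≈v u′ i) → span u ⊆ span u′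
  span-cong u u′ u≈u′ x (cs , x≈) = cs , ≈v-trans x≈ (lincomb-cong (λ _ → refl) u≈u′)

  LinIndep-cong : ∀ {n m} {u u′ : Fin m → Vec n} → (∀ i → u i ≈v u′ i) → LinIndep u → LinIndep u′
  LinIndep-cong u≈u′ u-indep cs u′≈0 = u-indep cs (≈v-trans (lincomb-cong (λ _ → refl) u≈u′) u′≈0)

  IsGenMatrix-cast : ∀ {n a b} (eq : a ≡ b) (u : Fin b → Vec n) → LinIndep u →
    IsGenMatrix (u ∘ Fin.cast eq) (span u)
  IsGenMatrix-cast P.refl u u-indep =
    LinIndep-cong u≈ u-indep , span-cong u _ u≈ , span-cong _ u (λ i → ≈v-sym (u≈ i))
    where
    u≈ : ∀ i → u i ≈v u (Fin.cast P.refl i)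
    u≈ i j = reflexive (P.cong (λ k → u k j) (P.sym (FinP.cast-is-id P.refl i)))

  span⊆spanSet : ∀ {n m} {X : Subset n} (g : Fin m → Vec n) → (∀ i → X (g i)) → span g ⊆ spanSet X
  span⊆spanSet g g∈X x x∈ = _ , g , g∈X , x∈

  ⊆spanSet : ∀ {n} {X : Subset n} → X ⊆ spanSet X
  ⊆spanSet x x∈X = 1 , (λ _ → x) , (λ _ → x∈X) , (λ _ → 1#) , λ j → sym (trans (+-identityʳ _) (*-identityˡ _))

  spanSet-least : ∀ {n} {X Q : Subset n} → IsSubspace Q → X ⊆ Q → spanSet X ⊆ Q
  spanSet-least Q-sub X⊆Q x (_ , g , g∈X , x∈) = span-least Q-sub g (λ i → X⊆Q _ (g∈X i)) x x∈

  spanSet-finite : ∀ {n b} {X : Subset n} (B : Fin b → Vec n) → (∀ i → spanSet X (B i)) →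
    ∃[ r ] Σ (Fin r → Vec n) λ ws → (∀ i → X (ws i)) × (∀ i → span ws (B i))
  spanSet-finite {b = zero} B B∈ = 0 , VF.[] , (λ ()) , (λ ())
  spanSet-finite {b = suc b} {X} B B∈ with B∈ Fin.zero | spanSet-finite {X = X} (B ∘ Fin.suc) (B∈ ∘ Fin.suc)
  ... | _ , us , us∈X , B₀∈ | _ , ws , ws∈X , B∈ws =
    _ , us VF.++ ws , all-++ {Q = X} us ws us∈X ws∈X ,
    λ { Fin.zero → span-++ˡ us ws _ B₀∈ ; (Fin.suc i) → span-++ʳ us ws _ (B∈ws i) }

  ≐-refl : ∀ {n} {A : Subset n} → A ≐ A
  ≐-refl = (λ _ x∈ → x∈) , (λ _ x∈ → x∈)

  ≐-sym : ∀ {n} {A B : Subset n} → A ≐ B → B ≐ A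
  ≐-sym (A⊆B , B⊆A) = B⊆A , A⊆B

  ≐-trans : ∀ {n} {A B C : Subset n} → A ≐ B → B ≐ C → A ≐ C
  ≐-trans (A⊆B , B⊆A) (B⊆C , C⊆B) = (λ x → B⊆C x ∘ A⊆B x) , (λ x → B⊆A x ∘ C⊆B x)

  IsProjectiveCode-resp-≐ : ∀ {n k} {C D : Subset n} → IsProjectiveCode k C → C ≐ D → IsProjectiveCode k D
  IsProjectiveCode-resp-≐ (G , (G-indep , C≐) , G-proj) C≐D = G , (G-indep , ≐-trans (≐-sym C≐D) C≐) , G-proj

  lincomb-at-pivot : ∀ {n m} (v : Fin m → Vec n) → IdentityPrefix v →
    ∀ (d : Fin m → Carrier) i l → toℕ l ≡ toℕ i → lincomb d v l ≈ d i
  lincomb-at-pivot {m = suc m} v v-prefix d i l l≡i = begin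
    lincomb d v l
      ≈⟨ sumv-punchIn (λ t → d t ·v v t) i l ⟩
    d i * v i l + lincomb (d ∘ punchIn i) (v ∘ punchIn i) l
      ≈⟨ +-cong (*-congˡ vil≈1) (lincomb-vanishes-at _ _ l v≈0) ⟩
    d i * 1# + 0#
      ≈⟨ +-identityʳ _ ⟩
    d i * 1#
      ≈⟨ *-identityʳ _ ⟩
    d i ∎
    where
    l<m : toℕ l < suc m
    l<m = P.subst (_< suc m) (P.sym l≡i) (FinP.toℕ<n i)
    vil≈1 : v i l ≈ 1#
    vil≈1 = proj₁ (v-prefix i l l<m) (P.sym l≡i)
    v≈0 : ∀ t → v (punchIn i t) l ≈ 0#
    v≈0 t = proj₂ (v-prefix (punchIn i t) l l<m)
              (λ eq → FinP.punchInᵢ≢i i t (FinP.toℕ-injective (P.trans eq l≡i)))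

  shear : ∀ {n k} (d : Fin (suc k) → Vec n) (j₀ : Fin (suc k)) (t : Fin k → Carrier) → Fin k → Vec n
  shear d j₀ t l = d (punchIn j₀ l) +v (t l ·v d j₀)

  shear-closed : ∀ {n k} {Q : Subset n} → IsSubspace Q → (d : Fin (suc k) → Vec n) (j₀ : Fin (suc k)) (t : Fin k → Carrier) →
    (∀ i → Q (d i)) → ∀ l → Q (shear d j₀ t l)
  shear-closed Q-sub d j₀ t d∈Q l = +v-closed Q-sub (d∈Q _) (·v-closed Q-sub _ (d∈Q j₀))

  shear-indep : ∀ {n k} (d : Fin (suc k) → Vec n) (j₀ : Fin (suc k)) (t : Fin k → Carrier) → LinIndep d →
    LinIndep (shear d j₀ t)
  shear-indep d j₀ t d-indep γ γ≈0 l =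
    trans (reflexive (P.sym (insertAt-punchIn γ j₀ σ l))) (d-indep δ δ≈0 (punchIn j₀ l))
    where
    σ = ∑ (λ i → γ i * t i)
    δ = VF.insertAt γ j₀ σ
    δ≈0 : lincomb δ d ≈v 0v
    δ≈0 j = begin
      lincomb δ d j
        ≈⟨ sumv-punchIn (λ i → δ i ·v d i) j₀ j ⟩
      δ j₀ * d j₀ j + lincomb (δ ∘ punchIn j₀) (d ∘ punchIn j₀) j
        ≈⟨ +-cong (*-congʳ (reflexive (insertAt-lookup γ j₀ σ)))
                  (lincomb-cong (λ l → reflexive (insertAt-punchIn γ j₀ σ l)) (λ _ → ≈v-refl) j) ⟩
      σ * d j₀ j + lincomb γ (d ∘ punchIn j₀) j
        ≈⟨ +-comm _ _ ⟩
      lincomb γ (d ∘ punchIn j₀) j + σ * d j₀ j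
        ≈⟨ lincomb-affine γ t (d ∘ punchIn j₀) (d j₀) j ⟨
      lincomb γ (shear d j₀ t) j
        ≈⟨ γ≈0 j ⟩
      0# ∎

  -- Gaussian-elimination multipliers for pivot row j₀, where b is the inverse of a j₀.
  clearing : ∀ {k} (a : Fin (suc k) → Carrier) (b : Carrier) (j₀ : Fin (suc k)) → Fin k → Carrier
  clearing a b j₀ l = -1# * (a (punchIn j₀ l) * b)

  clearing-clears : ∀ {k} (a : Fin (suc k) → Carrier) {b : Carrier} (j₀ : Fin (suc k)) → a j₀ * b ≈ 1# →
    ∀ l → a (punchIn j₀ l) + clearing a b j₀ l * a j₀ ≈ 0#
  clearing-clears a {b} j₀ ab l = begin
    x + -1# * (x * b) * a j₀  ≈⟨ +-congˡ (rearrange -1# x b (a j₀)) ⟩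
    x + -1# * (x * (a j₀ * b)) ≈⟨ +-congˡ (*-congˡ (trans (*-congˡ ab) (*-identityʳ x))) ⟩
    x + -1# * x               ≈⟨ x+-1*x≈0 x ⟩
    0#                        ∎
    where
    x = a (punchIn j₀ l)
    rearrange : ∀ n x b a → n * (x * b) * a ≈ n * (x * (a * b))
    rearrange = solve 4 (λ n x b a → (n :* (x :* b) :* a) := (n :* (x :* (a :* b)))) refl

  shear-clearing-closed : ∀ {n k} {Q : Subset n} → IsSubspace Q →
    (d r : Fin (suc k) → Vec n) (z : Vec n) (a : Fin (suc k) → Carrier) {b : Carrier} (j₀ : Fin (suc k)) →
    (∀ i → Q (r i)) → (∀ i → d i ≈v (r i +v (a i ·v z))) → a j₀ * b ≈ 1# →
    ∀ l → Q (shear d j₀ (clearing a b j₀) l)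
  shear-clearing-closed Q-sub d r z a {b} j₀ r∈Q d≈ ab l =
    resp-≈v Q-sub (λ j → sym (begin
      d (punchIn j₀ l) j + t * d j₀ j
        ≈⟨ +-cong (d≈ _ j) (*-congˡ (d≈ j₀ j)) ⟩
      (r (punchIn j₀ l) j + a (punchIn j₀ l) * z j) + t * (r j₀ j + a j₀ * z j)
        ≈⟨ rearrange _ _ (z j) t _ _ ⟩
      (r (punchIn j₀ l) j + t * r j₀ j) + (a (punchIn j₀ l) + t * a j₀) * z j
        ≈⟨ +-congˡ (trans (*-congʳ (clearing-clears a j₀ ab l)) (zeroˡ _)) ⟩
      (r (punchIn j₀ l) j + t * r j₀ j) + 0#
        ≈⟨ +-identityʳ _ ⟩
      r (punchIn j₀ l) j + t * r j₀ j ∎))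
      (+v-closed Q-sub (r∈Q _) (·v-closed Q-sub t (r∈Q j₀)))
    where
    t = clearing a b j₀ l
    rearrange : ∀ r a z t r′ a′ → (r + a * z) + t * (r′ + a′ * z) ≈ (r + t * r′) + (a + t * a′) * z
    rearrange = solve 6 (λ r a z t r′ a′ →
      ((r :+ a :* z) :+ t :* (r′ :+ a′ :* z)) := ((r :+ t :* r′) :+ (a :+ t :* a′) :* z)) refl

  lincomb-shear-clearing : ∀ {n k} (d : Fin (suc k) → Vec n) (a : Fin (suc k) → Carrier) {b : Carrier} (j₀ : Fin (suc k)) →
    a j₀ * b ≈ 1# → ∀ β → ∑ (λ i → β i * a i) ≈ 0# →
    lincomb β d ≈v lincomb (β ∘ punchIn j₀) (shear d j₀ (clearing a b j₀))
  lincomb-shear-clearing {k = k} d a {b} j₀ ab β βa≈0 j = begin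
    lincomb β d j
      ≈⟨ sumv-punchIn (λ i → β i ·v d i) j₀ j ⟩
    β j₀ * d j₀ j + lincomb (β ∘ punchIn j₀) (d ∘ punchIn j₀) j
      ≈⟨ +-comm _ _ ⟩
    lincomb (β ∘ punchIn j₀) (d ∘ punchIn j₀) j + β j₀ * d j₀ j
      ≈⟨ +-congˡ (*-congʳ coefficient) ⟨
    lincomb (β ∘ punchIn j₀) (d ∘ punchIn j₀) j + ∑ (λ l → β (punchIn j₀ l) * clearing a b j₀ l) * d j₀ j
      ≈⟨ lincomb-affine (β ∘ punchIn j₀) _ (d ∘ punchIn j₀) (d j₀) j ⟨
    lincomb (β ∘ punchIn j₀) (shear d j₀ (clearing a b j₀)) j ∎
    where
    β′ a′ : Fin k → Carrier
    β′ = β ∘ punchIn j₀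
    a′ = a ∘ punchIn j₀
    rest : ∑ (λ l → β′ l * a′ l) ≈ -1# * (β j₀ * a j₀)
    rest = x+y≈0⇒y≈-1*x (trans (sym (∑-punchIn (λ i → β i * a i) j₀)) βa≈0)
    coefficient : ∑ (λ l → β′ l * clearing a b j₀ l) ≈ β j₀
    coefficient = begin
      ∑ (λ l → β′ l * (-1# * (a′ l * b)))  ≈⟨ ∑-cong _ _ (λ l → regroup (β′ l) (a′ l) -1# b) ⟩
      ∑ (λ l → β′ l * a′ l * (-1# * b))     ≈⟨ ∑-distribʳ (λ l → β′ l * a′ l) (-1# * b) ⟩
      ∑ (λ l → β′ l * a′ l) * (-1# * b)     ≈⟨ *-congʳ rest ⟩
      -1# * (β j₀ * a j₀) * (-1# * b)       ≈⟨ swap (β j₀) (a j₀) -1# b ⟩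
      β j₀ * (a j₀ * b) * (-1# * -1#)       ≈⟨ *-cong (*-congˡ ab) -1*-1≈1 ⟩
      β j₀ * 1# * 1#                        ≈⟨ trans (*-identityʳ _) (*-identityʳ _) ⟩
      β j₀                                  ∎
      where
      regroup : ∀ β a n b → β * (n * (a * b)) ≈ β * a * (n * b)
      regroup = solve 4 (λ β a n b → (β :* (n :* (a :* b))) := (β :* a :* (n :* b))) refl
      swap : ∀ β a n b → n * (β * a) * (n * b) ≈ β * (a * b) * (n * n)
      swap = solve 4 (λ β a n b → (n :* (β :* a) :* (n :* b)) := (β :* (a :* b) :* (n :* n))) refl

  move-≈v : ∀ {n} {x r z : Vec n} {σ} → x ≈v (r +v (σ ·v z)) → (σ ·v z) ≈v (x +v (-1# ·v r))
  move-≈v {r = r} {z} {σ} x≈ j = sym (begin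
    _ + -1# * r j                ≈⟨ +-congʳ (x≈ j) ⟩
    r j + σ * z j + -1# * r j    ≈⟨ xy∙z≈y∙xz _ _ _ ⟩
    σ * z j + (r j + -1# * r j)  ≈⟨ +-congˡ (x+-1*x≈0 (r j)) ⟩
    σ * z j + 0#                 ≈⟨ +-identityʳ _ ⟩
    σ * z j                      ∎)

module FiniteVectorSpace {c ℓ} (F : CommutativeRing c ℓ) (isField : IsField F)
                         {q : ℕ} (card : HasCardinality F q) where
  open CommutativeRing F
  open Codes F
  open VectorSpace F

  private
    enum : Fin q → Carrier
    enum = proj₁ card

    enum-injective : ∀ i j → enum i ≈ enum j → i ≡ j
    enum-injective = proj₁ (proj₂ card)

    enum-surjective : ∀ x → ∃[ i ] (enum i ≈ x)
    enum-surjective = proj₂ (proj₂ card)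

  1≉0 : ¬ (1# ≈ 0#)
  1≉0 = proj₁ isField

  inverse : ∀ a → ¬ (a ≈ 0#) → ∃[ b ] (a * b ≈ 1#)
  inverse = proj₂ isField

  _≟_ : ∀ x y → Dec (x ≈ y)
  x ≟ y with enum-surjective x | enum-surjective y
  ... | i , i≈x | j , j≈y with i FinP.≟ j
  ... | yes P.refl = yes (trans (sym i≈x) j≈y)
  ... | no i≢j     = no (λ x≈y → i≢j (enum-injective i j (trans i≈x (trans x≈y (sym j≈y)))))

  _≟v_ : ∀ {n} (x y : Vec n) → Dec (x ≈v y)
  x ≟v y = FinP.all? (λ j → x j ≟ y j)

  -- The finiteness of F is used only here: an exhaustive search over coefficient vectors.
  ∃-coefficients? : ∀ {p} m (Q : (Fin m → Carrier) → Set p) →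
    (∀ cs ds → (∀ i → cs i ≈ ds i) → Q cs → Q ds) → (∀ cs → Dec (Q cs)) → Dec (∃ Q)
  ∃-coefficients? zero Q resp Q? with Q? (λ ())
  ... | yes hit = yes (_ , hit)
  ... | no miss = no λ { (cs , hit) → miss (resp cs _ (λ ()) hit) }
  ∃-coefficients? (suc m) Q resp Q?
    with FinP.any? (λ i → ∃-coefficients? m (Q ∘ (enum i VF.∷_)) (resp-∷ i) (Q? ∘ (enum i VF.∷_)))
    where
    resp-∷ : ∀ i cs ds → (∀ j → cs j ≈ ds j) → Q (enum i VF.∷ cs) → Q (enum i VF.∷ ds)
    resp-∷ i cs ds cs≈ds = resp _ _ λ { Fin.zero → refl ; (Fin.suc j) → cs≈ds j }
  ... | yes (_ , _ , hit) = yes (_ , hit)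
  ... | no miss = no λ { (cs , hit) → miss (proj₁ (enum-surjective (cs Fin.zero)) , cs ∘ Fin.suc ,
          resp cs _ (λ { Fin.zero → sym (proj₂ (enum-surjective (cs Fin.zero))) ; (Fin.suc j) → refl }) hit) }

  span? : ∀ {n m} (g : Fin m → Vec n) x → Dec (span g x)
  span? {m = m} g x = ∃-coefficients? m (λ cs → x ≈v lincomb cs g)
    (λ cs ds cs≈ds x≈ → ≈v-trans x≈ (lincomb-cong cs≈ds (λ _ → ≈v-refl))) (λ cs → x ≟v lincomb cs g)

  ≐span? : ∀ {n m} {C : Subset n} {g : Fin m → Vec n} → C ≐ span g → ∀ x → Dec (C x)
  ≐span? {g = g} (C⊆ , ⊆C) x with span? g x
  ... | yes x∈ = yes (⊆C x x∈)
  ... | no x∉  = no (x∉ ∘ C⊆ x)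

  ·v-cancel : ∀ {n} {Q : Subset n} → IsSubspace Q → ∀ a {x} → ¬ (a ≈ 0#) → Q (a ·v x) → Q x
  ·v-cancel Q-sub a {x} a≉0 ax∈Q with inverse a a≉0
  ... | b , ab≈1 = resp-≈v Q-sub b[ax]≈x (·v-closed Q-sub b ax∈Q)
    where
    b[ax]≈x : (b ·v (a ·v x)) ≈v x
    b[ax]≈x j = trans (sym (*-assoc b a (x j)))
                      (trans (*-congʳ (trans (*-comm b a) ab≈1)) (*-identityˡ _))

  ∉⇒coefficient≈0 : ∀ {n} {Q : Subset n} → IsSubspace Q → ∀ {x r z σ} →
    Q x → Q r → ¬ Q z → x ≈v (r +v (σ ·v z)) → σ ≈ 0#
  ∉⇒coefficient≈0 Q-sub {σ = σ} x∈Q r∈Q z∉Q x≈ with σ ≟ 0#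
  ... | yes σ≈0 = σ≈0
  ... | no σ≉0  = ⊥-elim (z∉Q (·v-cancel Q-sub σ σ≉0
                    (resp-≈v Q-sub (≈v-sym (move-≈v x≈)) (difference-closed Q-sub x∈Q r∈Q))))

  appendRow-indep : ∀ {n p} (u : Fin p → Vec n) x → LinIndep u → ¬ span u x → LinIndep (appendRow u x)
  appendRow-indep {p = p} u x u-indep x∉u cs eq = ↑-elim p (u-indep _ L≈0) (λ { Fin.zero → κ≈0 })
    where
    L = lincomb (cs ∘ (_↑ˡ 1)) u
    κ = cs (p ↑ʳ Fin.zero)
    0≈L+κx : 0v ≈v (L +v (κ ·v x))
    0≈L+κx j = sym (trans (+-congˡ (sym (+-identityʳ _)))
                          (trans (sym (lincomb-++ cs u (x VF.∷ VF.[]) j)) (eq j)))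
    κ≈0 : κ ≈ 0#
    κ≈0 = ∉⇒coefficient≈0 (span-isSubspace u) (0v-closed (span-isSubspace u)) (_ , ≈v-refl) x∉u 0≈L+κx
    L≈0 : L ≈v 0v
    L≈0 j = sym (trans (0≈L+κx j) (trans (+-congˡ (trans (*-congʳ κ≈0) (zeroˡ _))) (+-identityʳ _)))

  ∷[]-indep : ∀ {n} (x : Vec n) → ¬ (x ≈v 0v) → LinIndep (x VF.∷ VF.[])
  ∷[]-indep x x≉0 = appendRow-indep {p = 0} VF.[] x (λ _ _ ()) (x≉0 ∘ proj₂)

  pair-indep : ∀ {n} {Q₁ Q₂ : Subset n} {x y} → IsSubspace Q₁ → IsSubspace Q₂ →
    Q₁ x → Q₂ y → ¬ Q₂ x → ¬ Q₁ y → LinIndep (x VF.∷ y VF.∷ VF.[])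
  pair-indep Q₁-sub Q₂-sub x∈Q₁ y∈Q₂ x∉Q₂ y∉Q₁ cs eq Fin.zero =
    ∉⇒coefficient≈0 Q₂-sub (0v-closed Q₂-sub) (·v-closed Q₂-sub _ y∈Q₂) x∉Q₂
      (λ j → sym (trans (+-comm _ _) (trans (+-congˡ (sym (+-identityʳ _))) (eq j))))
  pair-indep Q₁-sub Q₂-sub x∈Q₁ y∈Q₂ x∉Q₂ y∉Q₁ cs eq (Fin.suc Fin.zero) =
    ∉⇒coefficient≈0 Q₁-sub (0v-closed Q₁-sub) (·v-closed Q₁-sub _ x∈Q₁) y∉Q₁
      (λ j → sym (trans (+-congˡ (sym (+-identityʳ _))) (eq j)))

  span-tail : ∀ {n m} (g : Fin (suc m) → Vec n) {x} cs → x ≈v lincomb cs g → cs Fin.zero ≈ 0# →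
    span (g ∘ Fin.suc) x
  span-tail g cs x≈ c₀≈0 =
    cs ∘ Fin.suc , λ j → trans (x≈ j) (trans (+-congʳ (trans (*-congʳ c₀≈0) (zeroˡ _))) (+-identityˡ _))

  -- Steinitz exchange: eliminate the first generator from all but one of the vectors u.
  indep-in-span⇒≤ : ∀ {n} m {p} (g : Fin m → Vec n) (u : Fin p → Vec n) →
    LinIndep u → (∀ i → span g (u i)) → p ≤ m
  indep-in-span⇒≤ zero {zero} g u u-indep u∈g = ℕ.z≤n
  indep-in-span⇒≤ zero {suc p} g u u-indep u∈g =
    contradiction (u-indep (unit Fin.zero) (≈v-trans (lincomb-unit u Fin.zero) (proj₂ (u∈g Fin.zero))) Fin.zero)
                  (1≉0 ∘ trans (sym (unit-diagonal {suc p} Fin.zero)))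
  indep-in-span⇒≤ (suc m) {zero} g u u-indep u∈g = ℕ.z≤n
  indep-in-span⇒≤ {n} (suc m) {suc p} g u u-indep u∈g with FinP.all? (λ i → proj₁ (u∈g i) Fin.zero ≟ 0#)
  ... | yes a≈0 =
    ℕP.m≤n⇒m≤1+n (indep-in-span⇒≤ m (g ∘ Fin.suc) u u-indep
                    (λ i → span-tail g (proj₁ (u∈g i)) (proj₂ (u∈g i)) (a≈0 i)))
  ... | no a≉0 = pivot (FinP.¬∀⟶∃¬ _ _ (λ i → proj₁ (u∈g i) Fin.zero ≟ 0#) a≉0)
    where
    a : Fin (suc p) → Carrier
    a i = proj₁ (u∈g i) Fin.zero
    r : Fin (suc p) → Vec n
    r i = lincomb (proj₁ (u∈g i) ∘ Fin.suc) (g ∘ Fin.suc)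
    u≈ : ∀ i → u i ≈v (r i +v (a i ·v g Fin.zero))
    u≈ i j = trans (proj₂ (u∈g i) j) (+-comm _ _)
    pivot : ∃[ i₀ ] ¬ (a i₀ ≈ 0#) → suc p ≤ suc m
    pivot (i₀ , aᵢ₀≉0) with inverse _ aᵢ₀≉0
    ... | b , ab≈1 = s≤s (indep-in-span⇒≤ m (g ∘ Fin.suc) (shear u i₀ (clearing a b i₀))
                            (shear-indep u i₀ _ u-indep)
                            (shear-clearing-closed (span-isSubspace (g ∘ Fin.suc)) u r (g Fin.zero) a i₀
                               (λ i → _ , ≈v-refl) u≈ ab≈1))

  indep-in-span⇒span⊆ : ∀ {n m p} (g : Fin m → Vec n) (u : Fin p → Vec n) → m ≤ p → LinIndep u →
    (∀ i → span g (u i)) → span g ⊆ span u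
  indep-in-span⇒span⊆ {m = m} {p} g u m≤p u-indep u∈g x x∈g with span? u x
  ... | yes x∈u = x∈u
  ... | no x∉u  = contradiction
    (ℕP.≤-trans (indep-in-span⇒≤ m g (appendRow u x) (appendRow-indep u x u-indep x∉u)
                   (all-++ u (x VF.∷ VF.[]) u∈g λ { Fin.zero → x∈g })) m≤p)
    (ℕP.m+1+n≰m p)

  generators⊆⇒≐ : ∀ {n k p} {C : Subset n} (c : Fin k → Vec n) (d : Fin p → Vec n) → k ≤ p →
    C ≐ span c → LinIndep d → (∀ j → C (d j)) → C ≐ span d
  generators⊆⇒≐ c d k≤p C≐ d-indep d∈C =
    (λ x x∈C → indep-in-span⇒span⊆ c d k≤p d-indep (λ j → proj₁ C≐ _ (d∈C j)) x (proj₁ C≐ x x∈C)) ,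
    span-least (≐-isSubspace C≐ (span-isSubspace c)) d d∈C

  dim-⊄-span : ∀ {n p m} {U : Subset n} → IsSubspaceOfDim p U → m < p → (g : Fin m → Vec n) → ¬ (U ⊆ span g)
  dim-⊄-span (G , G-indep , U≐) m<p g U⊆g =
    ℕP.<⇒≱ m<p (indep-in-span⇒≤ _ g G G-indep (λ i → U⊆g _ (proj₂ U≐ _ (generator∈span G i))))

  independent-pair : ∀ {n r} (ws : Fin r → Vec n) (B : Fin 2 → Vec n) → LinIndep B →
    (∀ i → span ws (B i)) → ∃[ i ] ∃[ j ] LinIndep (ws i VF.∷ ws j VF.∷ VF.[])
  independent-pair {n} ws B B-indep B∈ws with FinP.all? (λ i → ws i ≟v 0v)
  ... | yes ws≈0 = contradiction (indep-in-span⇒≤ 0 VF.[] B B-indep (λ i → ws⊆[] _ (B∈ws i))) λ ()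
    where
    ws⊆[] : span ws ⊆ span (VF.[] {A = Vec n})
    ws⊆[] = span-least []-sub ws λ t → resp-≈v []-sub (≈v-sym (ws≈0 t)) (0v-closed []-sub)
      where []-sub = span-isSubspace (VF.[] {A = Vec n})
  ... | no ws≉0 with FinP.¬∀⟶∃¬ _ _ (λ i → ws i ≟v 0v) ws≉0
  ... | i , wsᵢ≉0 with FinP.all? (λ j → span? (ws i VF.∷ VF.[]) (ws j))
  ... | yes ws⊆wsᵢ = contradiction
    (indep-in-span⇒≤ 1 (ws i VF.∷ VF.[]) B B-indep (λ t → span-least (span-isSubspace (ws i VF.∷ VF.[])) ws ws⊆wsᵢ _ (B∈ws t)))
    λ { (s≤s ()) }
  ... | no ws⊈wsᵢ with FinP.¬∀⟶∃¬ _ _ (λ j → span? (ws i VF.∷ VF.[]) (ws j)) ws⊈wsᵢ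
  ... | j , wsⱼ∉ = i , j , appendRow-indep (ws i VF.∷ VF.[]) (ws j) (∷[]-indep (ws i) wsᵢ≉0) wsⱼ∉

  dim2⇒pair : ∀ {n} {X : Subset n} → IsSubspaceOfDim 2 (spanSet X) →
    ∃[ x ] ∃[ y ] (X x × X y × LinIndep (x VF.∷ y VF.∷ VF.[]) × X ⊆ span (x VF.∷ y VF.∷ VF.[]))
  dim2⇒pair {X = X} (B , B-indep , ⟨X⟩≐B) with spanSet-finite {X = X} B (λ i → proj₂ ⟨X⟩≐B _ (generator∈span B i))
  ... | _ , ws , ws∈X , B∈ws with independent-pair ws B B-indep B∈ws
  ... | i , j , pair-indep = ws i , ws j , ws∈X i , ws∈X j , pair-indep , X⊆pair
    where
    X⊆B : X ⊆ span B
    X⊆B x x∈X = proj₁ ⟨X⟩≐B x (⊆spanSet x x∈X)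
    X⊆pair : X ⊆ span (ws i VF.∷ ws j VF.∷ VF.[])
    X⊆pair x x∈X = indep-in-span⇒span⊆ B (ws i VF.∷ ws j VF.∷ VF.[]) ℕP.≤-refl pair-indep
      (λ { Fin.zero → X⊆B _ (ws∈X i) ; (Fin.suc Fin.zero) → X⊆B _ (ws∈X j) }) x (X⊆B x x∈X)

  ∩-dim-outside : ∀ {n k r} {C D : Subset n} (c d : Fin (suc k) → Vec n) (h : Fin r → Vec n) →
    r ≤ suc k ℕ.+ 1 → IsGenMatrix c C → IsGenMatrix d D → C ⊆ span h → D ⊆ span h →
    ∀ j → ¬ C (d j) → IsSubspaceOfDim k (C ∩ D)
  ∩-dim-outside {n} {k} {C = C} {D} c d h r≤ (c-indep , C≐) (d-indep , D≐) C⊆h D⊆h j dⱼ∉C =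
    pivot (inverse (a j) aⱼ≉0)
    where
    C-sub = ≐-isSubspace C≐ (span-isSubspace c)
    D-sub = ≐-isSubspace D≐ (span-isSubspace d)
    d∈D : ∀ i → D (d i)
    d∈D i = proj₂ D≐ _ (generator∈span d i)
    c+dⱼ = appendRow c (d j)
    d∈c+dⱼ : ∀ i → span c+dⱼ (d i)
    d∈c+dⱼ i = indep-in-span⇒span⊆ h c+dⱼ r≤ (appendRow-indep c (d j) c-indep (dⱼ∉C ∘ proj₂ C≐ _))
      (all-++ {Q = span h} c (d j VF.∷ VF.[]) (λ i → C⊆h _ (proj₂ C≐ _ (generator∈span c i))) λ { Fin.zero → D⊆h _ (d∈D j) })
      _ (D⊆h _ (d∈D i))
    a : Fin (suc k) → Carrier
    a i = proj₁ (d∈c+dⱼ i) (suc k ↑ʳ Fin.zero)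
    r : Fin (suc k) → Vec n
    r i = lincomb (proj₁ (d∈c+dⱼ i) ∘ (_↑ˡ 1)) c
    r∈C : ∀ i → C (r i)
    r∈C i = proj₂ C≐ _ (proj₁ (d∈c+dⱼ i) ∘ (_↑ˡ 1) , ≈v-refl)
    d≈ : ∀ i → d i ≈v (r i +v (a i ·v d j))
    d≈ i l = trans (proj₂ (d∈c+dⱼ i) l)
                   (trans (lincomb-++ (proj₁ (d∈c+dⱼ i)) c (d j VF.∷ VF.[]) l) (+-congˡ (+-identityʳ _)))
    aⱼ≉0 : ¬ (a j ≈ 0#)
    aⱼ≉0 aⱼ≈0 = dⱼ∉C (resp-≈v C-sub (λ l → sym (trans (d≈ j l)
                  (trans (+-congˡ (trans (*-congʳ aⱼ≈0) (zeroˡ _))) (+-identityʳ _)))) (r∈C j))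
    pivot : ∃[ b ] (a j * b ≈ 1#) → IsSubspaceOfDim k (C ∩ D)
    pivot (b , ab≈1) = shear d j t , shear-indep d j t d-indep , ∩⊆shear ,
      span-least (∩-isSubspace C-sub D-sub) _
        (λ l → shear-clearing-closed C-sub d r (d j) a j r∈C d≈ ab≈1 l , shear-closed D-sub d j t d∈D l)
      where
      t = clearing a b j
      ∩⊆shear : (C ∩ D) ⊆ span (shear d j t)
      ∩⊆shear x (x∈C , x∈D) with proj₁ D≐ x x∈D
      ... | β , x≈ = β ∘ punchIn j , ≈v-trans x≈ (lincomb-shear-clearing d a j ab≈1 β βa≈0)
        where
        βa≈0 : ∑ (λ i → β i * a i) ≈ 0#
        βa≈0 = ∉⇒coefficient≈0 C-sub x∈C (lincomb-closed C-sub β r r∈C) dⱼ∉C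
                 (≈v-trans x≈ (≈v-trans (lincomb-cong {cs = β} {ds = β} (λ _ → refl) d≈) (lincomb-affine β a r (d j))))

  ∩-dim : ∀ {n k r} {C D : Subset n} (c d : Fin (suc k) → Vec n) (h : Fin r → Vec n) →
    r ≤ suc k ℕ.+ 1 → IsGenMatrix c C → IsGenMatrix d D → C ⊆ span h → D ⊆ span h →
    ¬ (C ≐ D) → IsSubspaceOfDim k (C ∩ D)
  ∩-dim c d h r≤ C-gen@(_ , C≐) D-gen@(d-indep , D≐) C⊆h D⊆h C≉D with FinP.all? (λ j → ≐span? {g = c} C≐ (d j))
  ... | yes d∈C = contradiction (≐-trans (generators⊆⇒≐ c d ℕP.≤-refl C≐ d-indep d∈C) (≐-sym D≐)) C≉D
  ... | no d∉C with FinP.¬∀⟶∃¬ _ _ (λ j → ≐span? {g = c} C≐ (d j)) d∉C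
  ... | j , dⱼ∉C = ∩-dim-outside c d h r≤ C-gen D-gen C⊆h D⊆h j dⱼ∉C

  -- An x ∈ D ∩ U outside C, a basis of D ∩ C and y would be k + 2 independent vectors of D.
  ∩U⊆hyperplane : ∀ {n k} {C D U : Subset n} (g : Fin (suc k) → Vec n) → IsGenMatrix g D →
    IsSubspaceOfDim k (D ∩ C) → IsSubspace U → C ⊆ U →
    ∀ {y} → D y → ¬ U y → ∀ x → D x → U x → C x
  ∩U⊆hyperplane {k = k} {C} {D} {U} g (_ , D≐) (B , B-indep , D∩C≐) U-sub C⊆U {y} y∈D y∉U x x∈D x∈U with span? B x
  ... | yes x∈B = proj₂ (proj₂ D∩C≐ x x∈B)
  ... | no x∉B  = contradiction (P.subst (λ z → z ℕ.+ 1 ≤ suc k) (ℕP.+-comm k 1) too-many) (ℕP.m+1+n≰m (suc k))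
    where
    B∈D∩C : ∀ i → (D ∩ C) (B i)
    B∈D∩C i = proj₂ D∩C≐ _ (generator∈span B i)
    Bx = appendRow B x
    Bx⊆U : span Bx ⊆ U
    Bx⊆U = span-least U-sub Bx (all-++ {Q = U} B (x VF.∷ VF.[]) (λ i → C⊆U _ (proj₂ (B∈D∩C i))) λ { Fin.zero → x∈U })
    too-many : k ℕ.+ 1 ℕ.+ 1 ≤ suc k
    too-many = indep-in-span⇒≤ (suc k) g (appendRow Bx y)
      (appendRow-indep Bx y (appendRow-indep B x B-indep x∉B) (y∉U ∘ Bx⊆U y))
      (all-++ {Q = span g} Bx (y VF.∷ VF.[]) (all-++ {Q = span g} B (x VF.∷ VF.[]) (λ i → proj₁ D≐ _ (proj₁ (B∈D∩C i))) λ { Fin.zero → proj₁ D≐ x x∈D })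
                   λ { Fin.zero → proj₁ D≐ y y∈D })

  clique-inside : ∀ {n k r} (h : Fin r → Vec n) → r ≤ suc k ℕ.+ 1 → (Y : VSet n) →
    (∀ D → Y D → IsProjectiveCode (suc k) D × (D ⊆ span h)) → IsClique (suc k) Y
  clique-inside {k = k} h r≤ Y Y⊆h = (λ C C∈Y → proj₁ (Y⊆h C C∈Y)) , adjacent
    where
    adjacent : ∀ C D → Y C → Y D → ¬ (C ≐ D) → Adjacent (suc k) C D
    adjacent C D C∈Y D∈Y C≉D with Y⊆h C C∈Y | Y⊆h D D∈Y
    ... | (c , C-gen , _) , C⊆h | (d , D-gen , _) , D⊆h = C≉D , ∩-dim c d h r≤ C-gen D-gen C⊆h D⊆h C≉D

  maximal-star⇒top⊆star : ∀ {n k r} {S : Subset n} (h : Fin r → Vec n) → r ≤ suc k ℕ.+ 1 →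
    IsStar (suc k) S → starSet (suc k) S ⊆V topSet (suc k) (span h) →
    topSet (suc k) (span h) ⊆V starSet (suc k) S
  maximal-star⇒top⊆star {n} {k} {S = S} h r≤ (_ , maximal) star⊆top C (C-proj , C⊆h) =
    maximal Y (clique-inside h r≤ Y Y⊆h) (λ _ → inj₁) C (inj₂ ≐-refl)
    where
    Y : VSet n
    Y D = starSet (suc k) S D ⊎ (D ≐ C)
    Y⊆h : ∀ D → Y D → IsProjectiveCode (suc k) D × (D ⊆ span h)
    Y⊆h D (inj₁ D∈star) = star⊆top D D∈star
    Y⊆h D (inj₂ D≐C)    = IsProjectiveCode-resp-≐ C-proj (≐-sym D≐C) , λ x x∈D → C⊆h x (proj₁ D≐C x x∈D)

module PrefixStar {c ℓ} (F : CommutativeRing c ℓ) (isField : IsField F) {q : ℕ} (card : HasCardinality F q)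
                  {n m : ℕ} (m≤n : m ≤ n) (v : Fin m → Codes.Vec F n) (v-prefix : Codes.IdentityPrefix F v) where
  open CommutativeRing F
  open Codes F
  open VectorSpace F
  open FiniteVectorSpace F isField card
  open SetoidReasoning setoid

  S W : Subset n
  S = span v
  W = Wset (suc m) v

  C⟨_⟩ : Vec n → Subset n
  C⟨ w ⟩ = span (appendRow v w)

  U⟨_,_⟩ : Vec n → Vec n → Subset n
  U⟨ w₁ , w₂ ⟩ = span (append2Rows v w₁ w₂)

  ZeroPrefix : Vec n → Set ℓ
  ZeroPrefix x = ∀ j → toℕ j < m → x j ≈ 0#

  pivot : Fin m → Fin n
  pivot i = Fin.inject≤ i m≤n

  toℕ-pivot : ∀ i → toℕ (pivot i) ≡ toℕ i
  toℕ-pivot i = FinP.toℕ-inject≤ i m≤n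

  pivot<m : ∀ i → toℕ (pivot i) < m
  pivot<m i = P.subst (_< m) (P.sym (toℕ-pivot i)) (FinP.toℕ<n i)

  v-indep : LinIndep v
  v-indep cs cs≈0 i = trans (sym (lincomb-at-pivot v v-prefix cs i (pivot i) (toℕ-pivot i))) (cs≈0 (pivot i))

  prefix-coefficient : ∀ {r} (ws : Fin r → Vec n) → (∀ t → ZeroPrefix (ws t)) →
    ∀ {x} cs → x ≈v lincomb cs (v VF.++ ws) → ∀ i → x (pivot i) ≈ cs (i ↑ˡ r)
  prefix-coefficient {r} ws ws-zero {x} cs x≈ i = begin
    x (pivot i)
      ≈⟨ x≈ (pivot i) ⟩
    lincomb cs (v VF.++ ws) (pivot i)
      ≈⟨ lincomb-++ cs v ws (pivot i) ⟩
    lincomb (cs ∘ (_↑ˡ r)) v (pivot i) + lincomb (cs ∘ (m ↑ʳ_)) ws (pivot i)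
      ≈⟨ +-cong (lincomb-at-pivot v v-prefix _ i (pivot i) (toℕ-pivot i))
                (lincomb-vanishes-at _ ws (pivot i) (λ t → ws-zero t (pivot i) (pivot<m i))) ⟩
    cs (i ↑ˡ r) + 0#
      ≈⟨ +-identityʳ _ ⟩
    cs (i ↑ˡ r) ∎

  v++-indep : ∀ {r} (ws : Fin r → Vec n) → (∀ t → ZeroPrefix (ws t)) → LinIndep ws → LinIndep (v VF.++ ws)
  v++-indep {r} ws ws-zero ws-indep cs cs≈0 = ↑-elim m v-coefficient (ws-indep _ ws-part≈0)
    where
    v-coefficient : ∀ a → cs (a ↑ˡ r) ≈ 0#
    v-coefficient a = sym (prefix-coefficient ws ws-zero cs (≈v-sym cs≈0) a)
    ws-part≈0 : lincomb (cs ∘ (m ↑ʳ_)) ws ≈v 0v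
    ws-part≈0 = ≈v-trans (≈v-sym (lincomb-++-zerosˡ cs v ws v-coefficient)) cs≈0

  zeroPrefix-∈-span : ∀ {r} (ws : Fin r → Vec n) → (∀ t → ZeroPrefix (ws t)) →
    ∀ x → ZeroPrefix x → span (v VF.++ ws) x → span ws x
  zeroPrefix-∈-span {r} ws ws-zero x x-zero (cs , x≈) =
    cs ∘ (m ↑ʳ_) , ≈v-trans x≈ (lincomb-++-zerosˡ cs v ws v-coefficient)
    where
    v-coefficient : ∀ a → cs (a ↑ˡ r) ≈ 0#
    v-coefficient a = trans (sym (prefix-coefficient ws ws-zero cs x≈ a)) (x-zero (pivot a) (pivot<m a))

  pivotEntries : Vec n → Fin m → Carrier
  pivotEntries x i = x (pivot i)

  reduce : Vec n → Vec n
  reduce x = x +v (-1# ·v lincomb (pivotEntries x) v)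

  reduce-zeroPrefix : ∀ x → ZeroPrefix (reduce x)
  reduce-zeroPrefix x l l<m = begin
    x l + -1# * lincomb (pivotEntries x) v l
      ≈⟨ +-congˡ (*-congˡ (lincomb-at-pivot v v-prefix _ i l (P.sym (FinP.toℕ-fromℕ< l<m)))) ⟩
    x l + -1# * x (pivot i)
      ≈⟨ +-congˡ (*-congˡ (reflexive (P.cong x pivot-i≡l))) ⟩
    x l + -1# * x l
      ≈⟨ x+-1*x≈0 (x l) ⟩
    0# ∎
    where
    i = Fin.fromℕ< l<m
    pivot-i≡l : pivot i ≡ l
    pivot-i≡l = FinP.toℕ-injective (P.trans (toℕ-pivot i) (FinP.toℕ-fromℕ< l<m))

  reduce-+ : ∀ x → x ≈v (reduce x +v lincomb (pivotEntries x) v)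
  reduce-+ x j = sym (begin
    x j + -1# * L + L    ≈⟨ +-assoc _ _ _ ⟩
    x j + (-1# * L + L)  ≈⟨ +-congˡ (trans (+-comm _ _) (x+-1*x≈0 L)) ⟩
    x j + 0#             ≈⟨ +-identityʳ _ ⟩
    x j                  ∎)
    where
    L = lincomb (pivotEntries x) v j

  v∈C : ∀ w i → C⟨ w ⟩ (v i)
  v∈C w i = span-++ˡ v (w VF.∷ VF.[]) _ (generator∈span v i)

  w∈C : ∀ w → C⟨ w ⟩ w
  w∈C w = span-++ʳ v (w VF.∷ VF.[]) _ (generator∈span (w VF.∷ VF.[]) Fin.zero)

  v∈U : ∀ w₁ w₂ i → U⟨ w₁ , w₂ ⟩ (v i)
  v∈U w₁ w₂ i = span-++ˡ v (w₁ VF.∷ w₂ VF.∷ VF.[]) _ (generator∈span v i)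

  w₁∈U : ∀ w₁ w₂ → U⟨ w₁ , w₂ ⟩ w₁
  w₁∈U w₁ w₂ = span-++ʳ v (w₁ VF.∷ w₂ VF.∷ VF.[]) _ (generator∈span (w₁ VF.∷ w₂ VF.∷ VF.[]) Fin.zero)

  w₂∈U : ∀ w₁ w₂ → U⟨ w₁ , w₂ ⟩ w₂
  w₂∈U w₁ w₂ = span-++ʳ v (w₁ VF.∷ w₂ VF.∷ VF.[]) _ (generator∈span (w₁ VF.∷ w₂ VF.∷ VF.[]) (Fin.suc Fin.zero))

  C⊆U : ∀ {w w₁ w₂} → U⟨ w₁ , w₂ ⟩ w → C⟨ w ⟩ ⊆ U⟨ w₁ , w₂ ⟩
  C⊆U {w} {w₁} {w₂} w∈U =
    span-least (span-isSubspace _) _ (all-++ {Q = U⟨ w₁ , w₂ ⟩} v (w VF.∷ VF.[]) (v∈U w₁ w₂) λ { Fin.zero → w∈U })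

  C∈star : ∀ {w} → W w → starSet (suc m) S C⟨ w ⟩
  C∈star {w} w∈W = proj₂ w∈W , span-++ˡ v (w VF.∷ VF.[])

  C-basis : Vec n → Fin (suc m) → Vec n
  C-basis w = appendRow v w ∘ Fin.cast (P.sym (ℕP.+-comm m 1))

  C-isGenMatrix : ∀ {w} → ¬ S w → IsGenMatrix (C-basis w) C⟨ w ⟩
  C-isGenMatrix {w} w∉S = IsGenMatrix-cast (P.sym (ℕP.+-comm m 1)) (appendRow v w) (appendRow-indep v w v-indep w∉S)

  pair-zeroPrefix : ∀ {w₁ w₂} → W w₁ → W w₂ → ∀ t → ZeroPrefix ((w₁ VF.∷ w₂ VF.∷ VF.[]) t)
  pair-zeroPrefix w₁∈W w₂∈W Fin.zero           = proj₁ w₁∈W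
  pair-zeroPrefix w₁∈W w₂∈W (Fin.suc Fin.zero) = proj₁ w₂∈W

  A₂-size : m ℕ.+ 2 ≤ suc m ℕ.+ 1
  A₂-size = ℕP.≤-reflexive (P.trans (ℕP.+-comm m 2) (P.sym (ℕP.+-comm (suc m) 1)))

  star⇒C : ∀ {C} → starSet (suc m) S C → ∃[ w ] (W w × C ≐ C⟨ w ⟩)
  star⇒C {C} (C-proj@(G , (G-indep , C≐) , _) , S⊆C) with FinP.all? (λ j → span? v (G j))
  ... | yes G⊆S = contradiction (indep-in-span⇒≤ m v G G-indep G⊆S) (ℕP.<-irrefl P.refl)
  ... | no G⊈S with FinP.¬∀⟶∃¬ _ _ (λ j → span? v (G j)) G⊈S
  ... | j , Gⱼ∉S = w , (reduce-zeroPrefix x , IsProjectiveCode-resp-≐ C-proj C≐C⟨w⟩) , C≐C⟨w⟩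
    where
    x = G j
    w = reduce x
    C-sub = ≐-isSubspace C≐ (span-isSubspace G)
    L∈S : S (lincomb (pivotEntries x) v)
    L∈S = _ , ≈v-refl
    w∈C′ : C w
    w∈C′ = difference-closed C-sub (proj₂ C≐ _ (generator∈span G j)) (S⊆C _ L∈S)
    w∉S : ¬ S w
    w∉S w∈S = Gⱼ∉S (resp-≈v (span-isSubspace v) (≈v-sym (reduce-+ x)) (+v-closed (span-isSubspace v) w∈S L∈S))
    C≐C⟨w⟩ : C ≐ C⟨ w ⟩
    C≐C⟨w⟩ = generators⊆⇒≐ G (appendRow v w) (ℕP.≤-reflexive (ℕP.+-comm 1 m)) C≐ (appendRow-indep v w v-indep w∉S)
               (all-++ {Q = C} v (w VF.∷ VF.[]) (λ i → S⊆C _ (generator∈span v i)) λ { Fin.zero → w∈C′ })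

  star⊆top : ∀ {r} (h : Fin r → Vec n) → (∀ i → span h (v i)) → W ⊆ span h →
    starSet (suc m) S ⊆V topSet (suc m) (span h)
  star⊆top h v∈h W⊆h C C∈star with star⇒C C∈star
  ... | w , w∈W , C≐C⟨w⟩ = proj₁ C∈star , λ x x∈C →
    span-least (span-isSubspace h) (appendRow v w) (all-++ {Q = span h} v (w VF.∷ VF.[]) v∈h λ { Fin.zero → W⊆h w w∈W })
      x (proj₁ C≐C⟨w⟩ x x∈C)

  U⊈C : ∀ {w₁ w₂ w} → IsSubspaceOfDim (suc (suc m)) U⟨ w₁ , w₂ ⟩ → ¬ (U⟨ w₁ , w₂ ⟩ ⊆ C⟨ w ⟩)
  U⊈C U-dim = dim-⊄-span U-dim (s≤s (ℕP.≤-reflexive (ℕP.+-comm m 1))) _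

  C∩C⊆S : ∀ {w₁ w₂} → ¬ C⟨ w₁ ⟩ w₂ → ¬ C⟨ w₂ ⟩ w₁ → (C⟨ w₁ ⟩ ∩ C⟨ w₂ ⟩) ⊆ S
  C∩C⊆S {w₁} {w₂} w₂∉C₁ w₁∉C₂ with meet
    where
    C₁≉C₂ : ¬ (C⟨ w₁ ⟩ ≐ C⟨ w₂ ⟩)
    C₁≉C₂ (_ , C₂⊆C₁) = w₂∉C₁ (C₂⊆C₁ _ (w∈C w₂))
    meet : IsSubspaceOfDim m (C⟨ w₁ ⟩ ∩ C⟨ w₂ ⟩)
    meet = ∩-dim (C-basis w₁) (C-basis w₂) (append2Rows v w₁ w₂) A₂-size
             (C-isGenMatrix (w₁∉C₂ ∘ span-++ˡ v _ w₁)) (C-isGenMatrix (w₂∉C₁ ∘ span-++ˡ v _ w₂))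
             (C⊆U (w₁∈U w₁ w₂)) (C⊆U (w₂∈U w₁ w₂)) C₁≉C₂
  ... | E , _ , E≐ = proj₁ (generators⊆⇒≐ E v ℕP.≤-refl E≐ v-indep (λ i → v∈C w₁ i , v∈C w₂ i))

  star-maximal : ∀ {w₁ w₂} → W w₁ → W w₂ → ¬ C⟨ w₁ ⟩ w₂ → ¬ C⟨ w₂ ⟩ w₁ →
    topSet (suc m) U⟨ w₁ , w₂ ⟩ ⊆V starSet (suc m) S →
    ∀ (Y : VSet n) → IsClique (suc m) Y → starSet (suc m) S ⊆V Y → Y ⊆V starSet (suc m) S
  star-maximal {w₁} {w₂} w₁∈W w₂∈W w₂∉C₁ w₁∉C₂ top⊆star Y (Y-codes , Y-adjacent) star⊆Y D D∈Y
    with Y-codes D D∈Y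
  ... | D-proj@(g , D-gen@(_ , D≐) , _) with FinP.all? (λ j → span? (append2Rows v w₁ w₂) (g j))
  ... | yes g⊆U = top⊆star D (D-proj , λ x x∈D → span-least (span-isSubspace _) g g⊆U x (proj₁ D≐ x x∈D))
  ... | no g⊈U with FinP.¬∀⟶∃¬ _ _ (λ j → span? (append2Rows v w₁ w₂) (g j)) g⊈U
  ... | j , gⱼ∉U = D-proj , S⊆D
    where
    gⱼ∈D : D (g j)
    gⱼ∈D = proj₂ D≐ _ (generator∈span g j)
    D≉C : ∀ {w} → U⟨ w₁ , w₂ ⟩ w → ¬ (D ≐ C⟨ w ⟩)
    D≉C w∈U (D⊆C , _) = gⱼ∉U (C⊆U w∈U _ (D⊆C _ gⱼ∈D))
    D∩C₁ : IsSubspaceOfDim m (D ∩ C⟨ w₁ ⟩)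
    D∩C₁ = proj₂ (Y-adjacent D _ D∈Y (star⊆Y _ (C∈star w₁∈W)) (D≉C (w₁∈U w₁ w₂)))
    D∩C₂ : IsSubspaceOfDim m (D ∩ C⟨ w₂ ⟩)
    D∩C₂ = proj₂ (Y-adjacent D _ D∈Y (star⊆Y _ (C∈star w₂∈W)) (D≉C (w₂∈U w₁ w₂)))
    B₁ = proj₁ D∩C₁
    B₁≐ = proj₂ (proj₂ D∩C₁)
    B₁⊆S : ∀ i → S (B₁ i)
    B₁⊆S i with proj₂ B₁≐ _ (generator∈span B₁ i)
    ... | x∈D , x∈C₁ = C∩C⊆S w₂∉C₁ w₁∉C₂ _
      (x∈C₁ , ∩U⊆hyperplane g D-gen D∩C₂ (span-isSubspace _) (C⊆U (w₂∈U w₁ w₂)) gⱼ∈D gⱼ∉U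
                _ x∈D (C⊆U (w₁∈U w₁ w₂) _ x∈C₁))
    S⊆D : S ⊆ D
    S⊆D x x∈S = proj₁ (proj₂ B₁≐ x (indep-in-span⇒span⊆ v B₁ ℕP.≤-refl (proj₁ (proj₂ D∩C₁)) B₁⊆S x x∈S))

  pair⇒⟨U] : IsStar (suc m) S → ∀ {w₁ w₂} → W w₁ → W w₂ → LinIndep (w₁ VF.∷ w₂ VF.∷ VF.[]) →
    W ⊆ span (w₁ VF.∷ w₂ VF.∷ VF.[]) →
    IsSubspaceOfDim (suc (suc m)) U⟨ w₁ , w₂ ⟩ × (starSet (suc m) S ≐V topSet (suc m) U⟨ w₁ , w₂ ⟩)
  pair⇒⟨U] star {w₁} {w₂} w₁∈W w₂∈W pair-indep W⊆pair =
    U-dim , star⊆U , maximal-star⇒top⊆star A₂ A₂-size star star⊆U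
    where
    pair = w₁ VF.∷ w₂ VF.∷ VF.[]
    A₂ = append2Rows v w₁ w₂
    star⊆U : starSet (suc m) S ⊆V topSet (suc m) U⟨ w₁ , w₂ ⟩
    star⊆U = star⊆top A₂ (v∈U w₁ w₂) λ w w∈W → span-++ʳ v pair w (W⊆pair w w∈W)
    U-dim : IsSubspaceOfDim (suc (suc m)) U⟨ w₁ , w₂ ⟩
    U-dim = A₂ ∘ Fin.cast (P.sym (ℕP.+-comm m 2)) ,
            IsGenMatrix-cast (P.sym (ℕP.+-comm m 2)) A₂ (v++-indep pair (pair-zeroPrefix w₁∈W w₂∈W) pair-indep)

  star⇒⟨U] : IsStar (suc m) S × IsSubspaceOfDim 2 (spanSet W) →
    ∃[ w₁ ] ∃[ w₂ ] (W w₁ × W w₂ × IsSubspaceOfDim (suc (suc m)) U⟨ w₁ , w₂ ⟩ ×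
                     (starSet (suc m) S ≐V topSet (suc m) U⟨ w₁ , w₂ ⟩))
  star⇒⟨U] (star , ⟨W⟩-dim) =
    let w₁ , w₂ , w₁∈W , w₂∈W , pair-indep , W⊆pair = dim2⇒pair ⟨W⟩-dim
    in  w₁ , w₂ , w₁∈W , w₂∈W , pair⇒⟨U] star w₁∈W w₂∈W pair-indep W⊆pair

  ⟨U]⇒star : ∃[ w₁ ] ∃[ w₂ ] (W w₁ × W w₂ × IsSubspaceOfDim (suc (suc m)) U⟨ w₁ , w₂ ⟩ ×
                               (starSet (suc m) S ≐V topSet (suc m) U⟨ w₁ , w₂ ⟩)) →
    IsStar (suc m) S × IsSubspaceOfDim 2 (spanSet W)
  ⟨U]⇒star (w₁ , w₂ , w₁∈W , w₂∈W , U-dim , star⊆U , U⊆star) =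
    (clique-inside A₂ A₂-size (starSet (suc m) S) star⊆U , star-maximal w₁∈W w₂∈W w₂∉C₁ w₁∉C₂ U⊆star) ,
    pair , pair-indep (span-isSubspace (appendRow v w₁)) (span-isSubspace (appendRow v w₂))
             (w∈C w₁) (w∈C w₂) w₁∉C₂ w₂∉C₁ ,
    spanSet-least (span-isSubspace pair) W⊆pair , span⊆spanSet {X = W} pair pair∈W
    where
    pair = w₁ VF.∷ w₂ VF.∷ VF.[]
    A₂ = append2Rows v w₁ w₂
    pair∈W : ∀ t → W (pair t)
    pair∈W Fin.zero           = w₁∈W
    pair∈W (Fin.suc Fin.zero) = w₂∈W
    w₂∉C₁ : ¬ C⟨ w₁ ⟩ w₂
    w₂∉C₁ w₂∈C₁ = U⊈C U-dim (span-least (span-isSubspace (appendRow v w₁)) A₂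
      (all-++ {Q = C⟨ w₁ ⟩} v pair (v∈C w₁) λ { Fin.zero → w∈C w₁ ; (Fin.suc Fin.zero) → w₂∈C₁ }))
    w₁∉C₂ : ¬ C⟨ w₂ ⟩ w₁
    w₁∉C₂ w₁∈C₂ = U⊈C U-dim (span-least (span-isSubspace (appendRow v w₂)) A₂
      (all-++ {Q = C⟨ w₂ ⟩} v pair (v∈C w₂) λ { Fin.zero → w₁∈C₂ ; (Fin.suc Fin.zero) → w∈C w₂ }))
    W⊆pair : W ⊆ span pair
    W⊆pair w w∈W = zeroPrefix-∈-span pair (pair-zeroPrefix w₁∈W w₂∈W) w (proj₁ w∈W)
                     (proj₂ (star⊆U _ (C∈star w∈W)) w (w∈C w))

proposition2 : ∀ {c ℓ} (F : CommutativeRing c ℓ) → IsField F →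
    (q : ℕ) → IsPrimePower q → HasCardinality F q →
    (n k : ℕ) → 1 < k → suc k < n →
    (v : Fin (k ∸ 1) → Codes.Vec F n) → Codes.IdentityPrefix F v →
    let open Codes F
        S = span v
        W = Wset k v
    in (IsStar k S × IsSubspaceOfDim 2 (spanSet W))
       ⇔ (∃[ w₁ ] ∃[ w₂ ] (W w₁ × W w₂ ×
            IsSubspaceOfDim (suc k) (span (append2Rows v w₁ w₂)) ×
            (starSet k S ≐V topSet k (span (append2Rows v w₁ w₂)))))
proposition2 F isField q _ card n zero () _ v v-prefix
proposition2 F isField q _ card n (suc m) _ 2+m<n v v-prefix = mk⇔ star⇒⟨U] ⟨U]⇒star
  where open PrefixStar F isField card (ℕP.m+n≤o⇒n≤o 3 2+m<n) v v-prefix
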